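{- For every $n\ge 1$, every integer $a_1$ with $1\le a_1\le 6$ and all nonnegative integers $a_2,\dots,a_n$, $$f^m(\langle 1\rangle; a_1,a_2,\dots,a_n)=f^1(\langle 1\rangle; a_1,a_2,\dots,a_n).$$
   Context: For a positive integer $a$ and an integer $b$, let $[b]_a:=\min(\operatorname{rem}(b,a),a-\operatorname{rem}(b,a))$, where $\operatorname{rem}(b,a)\in\{0,\dots,a-1\}$ is the remainder of $b$ modulo $a$. Consider labels $(\langle s\rangle; a_1,\dots,a_n)$ where $a_1,\dots,a_n$ are nonnegative integers, $s\in\{1,\dots,n\}$ and $a_s\ge1$. For an integer $k$ put $b^{(k)}=(b^{(k)}_1,\dots,b^{(k)}_n)$ with $b^{(k)}_s=a_s$ and $b^{(k)}_i=[k a_i]_{a_s}$ for $i\ne s$ (so $0\le b^{(k)}_i\le a_s/2<a_s$ for $i\neq s$). The function $f^1$ is defined recursively by: $f^1(\langle s\rangle;a_1,\dots,a_n)=1$ if $a_s=1$, and otherwise $$f^1(\langle s\rangle;a_1,\dots,a_n)=\sum_{j\ne s,\ b^{(1)}_j\ne 0} f^1(\langle j\rangle; b^{(1)}_1,\dots,b^{(1)}_n).$$ The function $f^m$ is defined recursively by: $f^m(\langle s\rangle;a_1,\dots,a_n)=1$ if $a_s=1$, and otherwise $$f^m(\langle s\rangle;a_1,\dots,a_n)=\min_{\substack{1\le k\le a_s-1\\ \gcd(k,a_s)=1}}\ \sum_{j\ne s,\ b^{(k)}_j\ne 0} f^m(\langle j\rangle; b^{(k)}_1,\dots,b^{(k)}_n),$$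 i.e. at each step an optimal valid multiplier $k$ (one coprime to the current index $a_s$ minimizing the resulting count) is used. (An empty sum is $0$.) These count the leaves of the decomposition tree of the denumerant cone with the multiplier $1$, respectively an optimal valid multiplier, chosen at every node. -}

module Defs where

open import Data.Nat using (ℕ; zero; suc; _*_; _∸_; _⊓_; _≟_)
open import Data.Nat.DivMod using (_%_)
open import Data.Nat.GCD using (gcd)
open import Data.Fin using (Fin) renaming (_≟_ to _≟ᶠ_)
open import Data.List using (List; []; _∷_; map; foldr; filterᵇ; upTo)
open import Data.Nat.ListAction using (sum)
open import Data.List using (allFin)
open import Data.Bool using (Bool; true; false; if_then_else_)
open import Relation.Nullary.Decidable using (⌊_⌋)

[_]_ : ℕ → ℕ → ℕ
[ b ] zero = 0
[ b ] (suc m) = (b % suc m) ⊓ (suc m ∸ (b % suc m))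

bvec : {n : ℕ} → Fin n → (Fin n → ℕ) → ℕ → Fin n → ℕ
bvec s a k i = if ⌊ i ≟ᶠ s ⌋ then a s else [ k * a i ] (a s)

childSum : {n : ℕ} → (Fin n → (Fin n → ℕ) → ℕ) → Fin n → (Fin n → ℕ) → ℕ
childSum {n} F s b = sum (map g (allFin n))
  where
  g : Fin n → ℕ
  g j = if ⌊ j ≟ᶠ s ⌋ then 0 else (if ⌊ b j ≟ 0 ⌋ then 0 else F j b)

validKs : ℕ → List ℕ
validKs a = filterᵇ (λ k → ⌊ gcd k a ≟ 1 ⌋) (map suc (upTo (a ∸ 1)))

minFrom : ℕ → List ℕ → ℕ
minFrom x xs = foldr _⊓_ x xs

-- Fuel-based versions: with fuel ≥ a_s they compute the recursively defined values
-- (children have label values b_j < a_s, so fuel decreases in step with a_s).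
f1-fuel : {n : ℕ} → ℕ → Fin n → (Fin n → ℕ) → ℕ
f1-fuel fuel s a with a s | fuel
... | zero | _ = 0
... | suc zero | _ = 1
... | suc (suc _) | zero = 0
... | suc (suc _) | suc fuel' = childSum (f1-fuel fuel') s (bvec s a 1)

fm-fuel : {n : ℕ} → ℕ → Fin n → (Fin n → ℕ) → ℕ
fm-fuel fuel s a with a s | fuel
... | zero | _ = 0
... | suc zero | _ = 1
... | suc (suc _) | zero = 0
... | suc (suc m) | suc fuel' =
  -- k = 1 is always valid (a_s ≥ 2), so starting the minimum there is harmless
  minFrom (val 1) (map val (validKs (suc (suc m))))
  where
  val : ℕ → ℕ
  val k = childSum (fm-fuel fuel') s (bvec s a k)

f¹ : {n : ℕ} → Fin n → (Fin n → ℕ) → ℕ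
f¹ s a = f1-fuel (a s) s a

fᵐ : {n : ℕ} → Fin n → (Fin n → ℕ) → ℕ
fᵐ s a = fm-fuel (a s) s a

-- A multiplier k coprime to a ∈ {2,3,4,6} is ±1 modulo a, and [−k x]_a = [k x]_a, so every
-- valid k yields the same child labels as k = 1.  For a = 5 the multipliers ±2 differ.  For
-- k = 1 or 2 all children have index at most 2; the leaves below a child of index 2 come from
-- the entries of odd index, i.e. the parent (index 5) and the p children of index 1, so the
-- node has p + q (1 + p) leaves, q the number of children of index 2.  Doubling modulo 5
-- exchanges [x]_5 = 1 and [x]_5 = 2, hence swaps p and q, and the count is symmetric.  By
-- induction on the index, f^m and f^1 agree on every child, so f^m = f^1.
module Submission where

open import Defs
open import Data.Nat using (ℕ; suc; _≤_)
open import Data.Fin using (Fin; zero)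
open import Relation.Binary.PropositionalEquality using (_≡_)

open import Data.Bool using (true; false; if_then_else_)
open import Data.Fin using () renaming (suc to fsuc; _≟_ to _≟ᶠ_)
open import Data.List using (List; []; _∷_; map; allFin)
open import Data.List.Properties using (map-cong; map-tabulate)
open import Data.List.Relation.Unary.All as All using (All; []; _∷_)
open import Data.List.Relation.Unary.All.Properties using (map⁺)
open import Data.Nat using (NonZero; zero; _<_; _+_; _*_; _∸_; _⊓_; _≟_; _≤?_; z≤n; s≤s)
open import Data.Nat.DivMod using (_%_; _/_; m%n<n; m%n%n≡m%n; %-distribˡ-*)
open import Data.Nat.ListAction using (sum)
open import Data.Nat.Properties
  using (allUpTo?; ≤-trans; ≤-refl; ≤-pred; n≤1+n; m⊓n≤n; m∸n≤m; ⊓-idem;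
         +-identityʳ; *-suc; *-comm; *-distribʳ-+; +-commutativeSemigroup)
open import Data.Empty using (⊥-elim)
open import Data.Sum using (_⊎_; inj₁; inj₂)
open import Data.Product using (_×_; _,_; proj₁; proj₂)
open import Relation.Nullary.Decidable using (Dec; yes; no; ⌊_⌋; from-yes; _⊎-dec_; _×-dec_)
open import Relation.Binary.PropositionalEquality
  using (_≢_; refl; sym; trans; cong; cong₂; subst; module ≡-Reasoning)
open import Algebra.Properties.CommutativeSemigroup +-commutativeSemigroup
  using (interchange; x∙yz≈y∙xz)
open ≡-Reasoning

sum-map-+ : {A : Set} (f g : A → ℕ) (xs : List A) →
            sum (map (λ x → f x + g x) xs) ≡ sum (map f xs) + sum (map g xs)
sum-map-+ f g [] = refl
sum-map-+ f g (x ∷ xs) =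
  trans (cong ((f x + g x) +_) (sum-map-+ f g xs)) (interchange (f x) (g x) _ _)

sum-map-*ʳ : {A : Set} (f : A → ℕ) (c : ℕ) (xs : List A) →
             sum (map (λ x → f x * c) xs) ≡ sum (map f xs) * c
sum-map-*ʳ f c [] = refl
sum-map-*ʳ f c (x ∷ xs) =
  trans (cong (f x * c +_) (sum-map-*ʳ f c xs)) (sym (*-distribʳ-+ c (f x) _))

except : {N : ℕ} → Fin N → (Fin N → ℕ) → Fin N → ℕ
except s g i = if ⌊ i ≟ᶠ s ⌋ then 0 else g i

-- childSum F s b unfolds to sumExcept s (λ j → if ⌊ b j ≟ 0 ⌋ then 0 else F j b).
sumExcept : {N : ℕ} → Fin N → (Fin N → ℕ) → ℕ
sumExcept {N} s g = sum (map (except s g) (allFin N))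

sumExcept-cong : ∀ {N} (s : Fin N) (g h : Fin N → ℕ) → (∀ i → i ≢ s → g i ≡ h i) →
                 sumExcept s g ≡ sumExcept s h
sumExcept-cong {N} s g h g≡h = cong sum (map-cong pointwise (allFin N))
  where
  pointwise : ∀ i → except s g i ≡ except s h i
  pointwise i with i ≟ᶠ s
  ... | yes _ = refl
  ... | no i≢s = g≡h i i≢s

sumExcept-+ : ∀ {N} (s : Fin N) (g h : Fin N → ℕ) →
              sumExcept s (λ i → g i + h i) ≡ sumExcept s g + sumExcept s h
sumExcept-+ {N} s g h =
  trans (cong sum (map-cong pointwise (allFin N))) (sum-map-+ (except s g) (except s h) (allFin N))
  where
  pointwise : ∀ i → except s (λ i → g i + h i) i ≡ except s g i + except s h i
  pointwise i with ⌊ i ≟ᶠ s ⌋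
  ... | true = refl
  ... | false = refl

sumExcept-*ʳ : ∀ {N} (s : Fin N) (g : Fin N → ℕ) (c : ℕ) →
               sumExcept s (λ i → g i * c) ≡ sumExcept s g * c
sumExcept-*ʳ {N} s g c =
  trans (cong sum (map-cong pointwise (allFin N))) (sum-map-*ʳ (except s g) c (allFin N))
  where
  pointwise : ∀ i → except s (λ i → g i * c) i ≡ except s g i * c
  pointwise i with ⌊ i ≟ᶠ s ⌋
  ... | true = refl
  ... | false = refl

map-allFin-suc : ∀ {N} (g : Fin (suc N) → ℕ) →
                 map g (allFin (suc N)) ≡ g zero ∷ map (λ i → g (fsuc i)) (allFin N)
map-allFin-suc {N} g =
  cong (g zero ∷_) (trans (map-tabulate fsuc g) (sym (map-tabulate (λ i → i) (λ i → g (fsuc i)))))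

except-suc : ∀ {N} (s i : Fin N) (g : Fin (suc N) → ℕ) →
             except (fsuc s) g (fsuc i) ≡ except s (λ i → g (fsuc i)) i
except-suc s i g with i ≟ᶠ s
... | yes _ = refl
... | no _ = refl

sumExcept-suc : ∀ {N} (s : Fin N) (g : Fin (suc N) → ℕ) →
                sumExcept (fsuc s) g ≡ g zero + sumExcept s (λ i → g (fsuc i))
sumExcept-suc {N} s g = begin
  sum (map (except (fsuc s) g) (allFin (suc N)))
    ≡⟨ cong sum (map-allFin-suc (except (fsuc s) g)) ⟩
  g zero + sum (map (λ i → except (fsuc s) g (fsuc i)) (allFin N))
    ≡⟨ cong (λ xs → g zero + sum xs) (map-cong (λ i → except-suc s i g) (allFin N)) ⟩
  g zero + sumExcept s (λ i → g (fsuc i)) ∎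

sum-allFin-split : ∀ {N} (s : Fin N) (g : Fin N → ℕ) → sum (map g (allFin N)) ≡ g s + sumExcept s g
sum-allFin-split {suc N} zero g =
  trans (cong sum (map-allFin-suc g)) (cong (g zero +_) (sym (cong sum (map-allFin-suc (except zero g)))))
sum-allFin-split {suc N} (fsuc s) g = begin
  sum (map g (allFin (suc N)))                           ≡⟨ cong sum (map-allFin-suc g) ⟩
  g zero + sum (map (λ i → g (fsuc i)) (allFin N))       ≡⟨ cong (g zero +_) (sum-allFin-split s _) ⟩
  g zero + (g (fsuc s) + sumExcept s (λ i → g (fsuc i))) ≡⟨ x∙yz≈y∙xz (g zero) (g (fsuc s)) _ ⟩
  g (fsuc s) + (g zero + sumExcept s (λ i → g (fsuc i))) ≡⟨ cong (g (fsuc s) +_) (sym (sumExcept-suc s g)) ⟩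
  g (fsuc s) + sumExcept (fsuc s) g                      ∎

sumExcept-move : ∀ {N} (j s : Fin N) (h : Fin N → ℕ) → h j ≡ 0 → h s ≡ 1 →
                 sumExcept j h ≡ suc (sumExcept s h)
sumExcept-move {N} j s h hj≡0 hs≡1 = begin
  sumExcept j h           ≡⟨ cong (_+ sumExcept j h) (sym hj≡0) ⟩
  h j + sumExcept j h     ≡⟨ sym (sum-allFin-split j h) ⟩
  sum (map h (allFin N))  ≡⟨ sum-allFin-split s h ⟩
  h s + sumExcept s h     ≡⟨ cong (_+ sumExcept s h) hs≡1 ⟩
  suc (sumExcept s h)     ∎

[m*n]%o≡[m*[n%o]]%o : ∀ m n o .{{_ : NonZero o}} → (m * n) % o ≡ (m * (n % o)) % o
[m*n]%o≡[m*[n%o]]%o m n o = begin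
  (m * n) % o                   ≡⟨ %-distribˡ-* m n o ⟩
  ((m % o) * (n % o)) % o       ≡⟨ cong (λ t → ((m % o) * t) % o) (sym (m%n%n≡m%n n o)) ⟩
  ((m % o) * (n % o % o)) % o   ≡⟨ sym (%-distribˡ-* m (n % o) o) ⟩
  (m * (n % o)) % o             ∎

bracket-mod : ∀ n y → [ y ] (suc n) ≡ [ y % suc n ] (suc n)
bracket-mod n y = cong (λ t → t ⊓ (suc n ∸ t)) (sym (m%n%n≡m%n y (suc n)))

bracket-*-mod : ∀ n k x → [ k * x ] (suc n) ≡ [ k * (x % suc n) ] (suc n)
bracket-*-mod n k x = cong (λ t → t ⊓ (suc n ∸ t)) ([m*n]%o≡[m*[n%o]]%o k x (suc n))

bracket-≤ : ∀ n y → [ y ] (suc n) ≤ n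
bracket-≤ n y with y % suc n
... | zero = z≤n
... | suc r = ≤-trans (m⊓n≤n (suc r) (n ∸ r)) (m∸n≤m n r)

bracket-2 : ∀ x → [ x ] 2 ≡ x % 2
bracket-2 x with x % 2 | m%n<n x 2
... | 0 | _ = refl
... | 1 | _ = refl
... | suc (suc _) | s≤s (s≤s ())

bracket-5-≤ : ∀ y → [ y ] 5 ≤ 2
bracket-5-≤ y = subst (_≤ 2) (sym (bracket-mod 4 y))
  (from-yes (allUpTo? (λ r → [ r ] 5 ≤? 2) 5) (m%n<n y 5))

-- Doubling modulo 5 exchanges the bracket values 1 and 2, which are told apart by _% 2 and _/ 2.
bracket-5-doubling : ∀ x → [ 2 * x ] 5 % 2 ≡ [ 1 * x ] 5 / 2 × [ 2 * x ] 5 / 2 ≡ [ 1 * x ] 5 % 2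
bracket-5-doubling x rewrite bracket-*-mod 4 2 x | bracket-*-mod 4 1 x =
  from-yes (allUpTo? (λ r → ([ 2 * r ] 5 % 2 ≟ [ 1 * r ] 5 / 2) ×-dec ([ 2 * r ] 5 / 2 ≟ [ 1 * r ] 5 % 2)) 5)
    (m%n<n x 5)

SameBrackets : ℕ → ℕ → ℕ → Set
SameBrackets n k k' = ∀ {r} → r < n → [ k * r ] n ≡ [ k' * r ] n

sameBrackets? : ∀ n k k' → Dec (SameBrackets n k k')
sameBrackets? n k k' = allUpTo? (λ r → [ k * r ] n ≟ [ k' * r ] n) n

sameBrackets-everywhere : ∀ {n} k k' → SameBrackets (suc n) k k' →
                          ∀ x → [ k * x ] (suc n) ≡ [ k' * x ] (suc n)
sameBrackets-everywhere {n} k k' same x = begin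
  [ k * x ] (suc n)              ≡⟨ bracket-*-mod n k x ⟩
  [ k * (x % suc n) ] (suc n)    ≡⟨ same (m%n<n x (suc n)) ⟩
  [ k' * (x % suc n) ] (suc n)   ≡⟨ sym (bracket-*-mod n k' x) ⟩
  [ k' * x ] (suc n)             ∎

ValidMultipliersUpTo6 : ℕ → Set
ValidMultipliersUpTo6 n = All (λ k → SameBrackets n k 1 ⊎ (n ≡ 5 × SameBrackets n k 2)) (validKs n)

validMultipliersUpTo6 : ∀ {n} → n ≤ 6 → ValidMultipliersUpTo6 n
validMultipliersUpTo6 n≤6 = from-yes (allUpTo? valid? 7) (s≤s n≤6)
  where
  valid? : ∀ n → Dec (ValidMultipliersUpTo6 n)
  valid? n = All.all? (λ k → sameBrackets? n k 1 ⊎-dec ((n ≟ 5) ×-dec sameBrackets? n k 2)) (validKs n)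

bvec-self : ∀ {N} (s : Fin N) a k → bvec s a k s ≡ a s
bvec-self s a k with s ≟ᶠ s
... | yes _ = refl
... | no s≢s = ⊥-elim (s≢s refl)

bvec-other : ∀ {N} (s i : Fin N) a k → i ≢ s → bvec s a k i ≡ [ k * a i ] (a s)
bvec-other s i a k i≢s with i ≟ᶠ s
... | yes i≡s = ⊥-elim (i≢s i≡s)
... | no _ = refl

bvec-cong : ∀ {N} (s : Fin N) {a a' : Fin N → ℕ} k → (∀ i → a i ≡ a' i) →
            ∀ i → bvec s a k i ≡ bvec s a' k i
bvec-cong s k a≗a' i with i ≟ᶠ s
... | yes _ = a≗a' s
... | no _ = cong₂ (λ x n → [ k * x ] n) (a≗a' i) (a≗a' s)

bvec-other-≤ : ∀ {N} (s i : Fin N) a k {n} → a s ≡ suc n → i ≢ s → bvec s a k i ≤ n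
bvec-other-≤ s i a k {n} as≡ i≢s =
  subst (_≤ n) (sym (trans (bvec-other s i a k i≢s) (cong ([ k * a i ]_) as≡))) (bracket-≤ n (k * a i))

bvec-multiplier-cong : ∀ {N} (s : Fin N) a {n k k'} → a s ≡ suc n →
  (∀ x → [ k * x ] (suc n) ≡ [ k' * x ] (suc n)) → ∀ i → bvec s a k i ≡ bvec s a k' i
bvec-multiplier-cong s a as≡ same i with i ≟ᶠ s
... | yes _ = refl
... | no _ rewrite as≡ = same (a i)

childSum-cong : ∀ {N} (F G : Fin N → (Fin N → ℕ) → ℕ) (s : Fin N) {b c : Fin N → ℕ} →
  (∀ i → b i ≡ c i) → (∀ j → j ≢ s → F j b ≡ G j c) → childSum F s b ≡ childSum G s c
childSum-cong F G s b≗c F≡G = sumExcept-cong s _ _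
  (λ j j≢s → cong₂ (λ x t → if ⌊ x ≟ 0 ⌋ then 0 else t) (b≗c j) (F≡G j j≢s))

f1-fuel-cong : ∀ f {N} (s : Fin N) {b b' : Fin N → ℕ} → (∀ i → b i ≡ b' i) →
               f1-fuel f s b ≡ f1-fuel f s b'
f1-fuel-cong f s {b} {b'} b≗b' with b s | b' s | b≗b' s
... | zero | .zero | refl = refl
... | suc zero | .(suc zero) | refl = refl
... | suc (suc _) | .(suc (suc _)) | refl with f
...   | zero = refl
...   | suc f' = childSum-cong (f1-fuel f') (f1-fuel f') s (bvec-cong s 1 b≗b')
                   (λ j _ → f1-fuel-cong f' j (bvec-cong s 1 b≗b'))

f1-fuel-leaf-or-absent : ∀ f {N} (i : Fin N) c → c i ≤ 1 →
                         (if ⌊ c i ≟ 0 ⌋ then 0 else f1-fuel f i c) ≡ c i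
f1-fuel-leaf-or-absent f i c ci≤1 with c i | ci≤1
... | 0 | _ = refl
... | 1 | _ = refl
... | suc (suc _) | s≤s ()

-- Below a node of index 2 every child has index [b_i]_2 ∈ {0, 1}, so it is a leaf or absent.
childSum-f1-fuel-at-2 : ∀ f {N} (j : Fin N) b → b j ≡ 2 →
                        childSum (f1-fuel f) j (bvec j b 1) ≡ sumExcept j (λ i → b i % 2)
childSum-f1-fuel-at-2 f j b bj≡2 = sumExcept-cong j _ _ summand
  where
  c : Fin _ → ℕ
  c = bvec j b 1
  c≡parity : ∀ i → i ≢ j → c i ≡ b i % 2
  c≡parity i i≢j = begin
    c i               ≡⟨ bvec-other j i b 1 i≢j ⟩
    [ 1 * b i ] (b j) ≡⟨ cong ([ 1 * b i ]_) bj≡2 ⟩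
    [ 1 * b i ] 2     ≡⟨ bracket-2 (1 * b i) ⟩
    (1 * b i) % 2     ≡⟨ cong (_% 2) (+-identityʳ (b i)) ⟩
    b i % 2           ∎
  summand : ∀ i → i ≢ j → (if ⌊ c i ≟ 0 ⌋ then 0 else f1-fuel f i c) ≡ b i % 2
  summand i i≢j = trans (f1-fuel-leaf-or-absent f i c ci≤1) (c≡parity i i≢j)
    where
    ci≤1 : c i ≤ 1
    ci≤1 = subst (_≤ 1) (sym (c≡parity i i≢j)) (≤-pred (m%n<n (b i) 2))

childSum-f1-fuel-at-5 : ∀ f {N} (s : Fin N) b → b s ≡ 5 → (∀ i → i ≢ s → b i ≤ 2) →
  let ones = sumExcept s (λ i → b i % 2); twos = sumExcept s (λ i → b i / 2) in
  childSum (f1-fuel (suc f)) s b ≡ ones + twos * suc ones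
childSum-f1-fuel-at-5 f s b bs≡5 b≤2 = begin
  childSum (f1-fuel (suc f)) s b                   ≡⟨ sumExcept-cong s _ _ summand ⟩
  sumExcept s (λ j → b j % 2 + b j / 2 * suc ones) ≡⟨ sumExcept-+ s _ _ ⟩
  ones + sumExcept s (λ j → b j / 2 * suc ones)    ≡⟨ cong (ones +_) (sumExcept-*ʳ s _ (suc ones)) ⟩
  ones + twos * suc ones                           ∎
  where
  ones twos : ℕ
  ones = sumExcept s (λ i → b i % 2)
  twos = sumExcept s (λ i → b i / 2)
  summand : ∀ j → j ≢ s →
            (if ⌊ b j ≟ 0 ⌋ then 0 else f1-fuel (suc f) j b) ≡ b j % 2 + b j / 2 * suc ones
  summand j j≢s with b j in bj≡ | b≤2 j j≢s
  ... | 0 | _ = refl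
  ... | 1 | _ = refl
  ... | 2 | _ = begin
    childSum (f1-fuel f) j (bvec j b 1) ≡⟨ childSum-f1-fuel-at-2 f j b bj≡ ⟩
    sumExcept j (λ i → b i % 2)        ≡⟨ sumExcept-move j s _ (cong (_% 2) bj≡) (cong (_% 2) bs≡5) ⟩
    suc ones                           ≡⟨ sym (+-identityʳ (suc ones)) ⟩
    suc ones + 0                       ∎
  ... | suc (suc (suc _)) | s≤s (s≤s ())

leaf-count-symmetric : ∀ p q → p + q * suc p ≡ q + p * suc q
leaf-count-symmetric p q = begin
  p + q * suc p    ≡⟨ cong (p +_) (*-suc q p) ⟩
  p + (q + q * p)  ≡⟨ x∙yz≈y∙xz p q (q * p) ⟩
  q + (p + q * p)  ≡⟨ cong (λ t → q + (p + t)) (*-comm q p) ⟩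
  q + (p + p * q)  ≡⟨ cong (q +_) (sym (*-suc p q)) ⟩
  q + p * suc q    ∎

childSum-f1-multiplier-cong : ∀ f {N} (s : Fin N) a k k' {n} → a s ≡ suc n → SameBrackets (suc n) k k' →
  childSum (f1-fuel f) s (bvec s a k) ≡ childSum (f1-fuel f) s (bvec s a k')
childSum-f1-multiplier-cong f s a k k' {n} as≡ same =
  childSum-cong (f1-fuel f) (f1-fuel f) s children-equal (λ j _ → f1-fuel-cong f j children-equal)
  where
  children-equal : ∀ i → bvec s a k i ≡ bvec s a k' i
  children-equal = bvec-multiplier-cong s a {n} {k} {k'} as≡ (sameBrackets-everywhere k k' same)

childSum-f1-doubling-at-5 : ∀ f {N} (s : Fin N) a → a s ≡ 5 →
  childSum (f1-fuel (suc f)) s (bvec s a 2) ≡ childSum (f1-fuel (suc f)) s (bvec s a 1)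
childSum-f1-doubling-at-5 f s a as≡5 = begin
  childSum (f1-fuel (suc f)) s (bvec s a 2) ≡⟨ childSum-f1-fuel-at-5 f s (bvec s a 2) (index 2) (≤2 2) ⟩
  ones 2 + twos 2 * suc (ones 2)            ≡⟨ cong₂ (λ p q → p + q * suc p) ones₂≡twos₁ twos₂≡ones₁ ⟩
  twos 1 + ones 1 * suc (twos 1)            ≡⟨ leaf-count-symmetric (twos 1) (ones 1) ⟩
  ones 1 + twos 1 * suc (ones 1)            ≡⟨ sym (childSum-f1-fuel-at-5 f s (bvec s a 1) (index 1) (≤2 1)) ⟩
  childSum (f1-fuel (suc f)) s (bvec s a 1) ∎
  where
  ones twos : ℕ → ℕ
  ones k = sumExcept s (λ i → bvec s a k i % 2)
  twos k = sumExcept s (λ i → bvec s a k i / 2)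
  index : ∀ k → bvec s a k s ≡ 5
  index k = trans (bvec-self s a k) as≡5
  entry : ∀ k i → i ≢ s → bvec s a k i ≡ [ k * a i ] 5
  entry k i i≢s = trans (bvec-other s i a k i≢s) (cong ([ k * a i ]_) as≡5)
  ≤2 : ∀ k i → i ≢ s → bvec s a k i ≤ 2
  ≤2 k i i≢s = subst (_≤ 2) (sym (entry k i i≢s)) (bracket-5-≤ (k * a i))
  ones₂≡twos₁ : ones 2 ≡ twos 1
  ones₂≡twos₁ = sumExcept-cong s _ _ λ i i≢s →
    trans (cong (_% 2) (entry 2 i i≢s))
          (trans (proj₁ (bracket-5-doubling (a i))) (cong (_/ 2) (sym (entry 1 i i≢s))))
  twos₂≡ones₁ : twos 2 ≡ ones 1
  twos₂≡ones₁ = sumExcept-cong s _ _ λ i i≢s →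
    trans (cong (_/ 2) (entry 2 i i≢s))
          (trans (proj₂ (bracket-5-doubling (a i))) (cong (_% 2) (sym (entry 1 i i≢s))))

validKs-agree : ∀ f {N} (s : Fin N) a {n} → a s ≡ suc n → suc n ≤ 6 → 1 ≤ f →
  All (λ k → childSum (f1-fuel f) s (bvec s a k) ≡ childSum (f1-fuel f) s (bvec s a 1)) (validKs (suc n))
validKs-agree (suc f) s a {n} as≡ n≤6 _ = All.map (λ {k} → agree {k}) (validMultipliersUpTo6 n≤6)
  where
  agree : ∀ {k} → SameBrackets (suc n) k 1 ⊎ (suc n ≡ 5 × SameBrackets (suc n) k 2) →
          childSum (f1-fuel (suc f)) s (bvec s a k) ≡ childSum (f1-fuel (suc f)) s (bvec s a 1)
  agree {k} (inj₁ k≈1) = childSum-f1-multiplier-cong (suc f) s a k 1 as≡ k≈1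
  agree {k} (inj₂ (n≡5 , k≈2)) = trans (childSum-f1-multiplier-cong (suc f) s a k 2 as≡ k≈2)
                                       (childSum-f1-doubling-at-5 f s a (trans as≡ n≡5))

minFrom-const : ∀ {x v : ℕ} {xs} → x ≡ v → All (_≡ v) xs → minFrom x xs ≡ v
minFrom-const x≡v [] = x≡v
minFrom-const {v = v} x≡v (refl ∷ ys≡v) = trans (cong (v ⊓_) (minFrom-const x≡v ys≡v)) (⊓-idem v)

fm-fuel≡f1-fuel : ∀ fuel {N} (s : Fin N) a → a s ≤ 6 → a s ≤ fuel → fm-fuel fuel s a ≡ f1-fuel fuel s a
fm-fuel≡f1-fuel fuel s a as≤6 as≤fuel with a s in as≡ | fuel
... | zero        | _     = refl
... | suc zero    | _     = refl
... | suc (suc m) | zero  = refl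
... | suc (suc m) | suc f =
  minFrom-const (children 1) (map⁺ (All.map (λ {k} → trans (children k)) (validKs-agree f s a as≡ as≤6 1≤f)))
  where
  m<f : suc m ≤ f
  m<f = ≤-pred as≤fuel
  1≤f : 1 ≤ f
  1≤f = ≤-trans (s≤s z≤n) m<f
  children : ∀ k → childSum (fm-fuel f) s (bvec s a k) ≡ childSum (f1-fuel f) s (bvec s a k)
  children k = childSum-cong (fm-fuel f) (f1-fuel f) s {bvec s a k} (λ _ → refl) λ j j≢s →
    let child≤ = bvec-other-≤ s j a k as≡ j≢s in
    fm-fuel≡f1-fuel f j (bvec s a k) (≤-trans child≤ (≤-trans (n≤1+n _) as≤6)) (≤-trans child≤ m<f)

-- The hypothesis 1 ≤ a zero is not needed: for index 0 both sides are 0.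
lemma13 : (n : ℕ) (a : Fin (suc n) → ℕ) → 1 ≤ a zero → a zero ≤ 6 →
          fᵐ zero a ≡ f¹ zero a
lemma13 n a _ a₀≤6 = fm-fuel≡f1-fuel (a zero) zero a a₀≤6 ≤-refl
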